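{- For every integer $k \geq 3$, the maximum chromatic number of $k$-queue graphs is at least $2k+2$; that is, there exists a $k$-queue graph with chromatic number at least $2k+2$.
   Context: For $k\in\mathbb{N}$, a graph is a $k$-queue graph if its vertices can be linearly ordered and its edges partitioned into $k$ sets (queues) such that no queue contains two edges $\{a,d\}$, $\{b,c\}$ with $a<b<c<d$ in the ordering. Equivalently, a graph is a $k$-queue graph if it admits a linear ordering of its vertices such that the resulting ordered graph does not contain the nested matching $NM^<_{k+1}$ as an ordered subgraph, where $NM^<_m$ is the ordered graph on $\{1,\dots,2m\}$ with edges $\{i,2m-i+1\}$ for $i=1,\dots,m$, and an ordered graph $G^<$ on $[n]$ is an ordered subgraph of an ordered graph $H^<$ on $[N]$ if there is an increasing map $\phi:[n]\to[N]$ sending edges of $G^<$ to edges of $H^<$. -}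

module Defs where

open import Data.Nat using (ℕ)
open import Data.Fin using (Fin; _<_)
open import Data.Fin.Permutation using (Permutation′; _⟨$⟩ʳ_)
open import Data.Product using (Σ; _×_)
open import Relation.Binary.PropositionalEquality using (_≡_; _≢_)
open import Relation.Nullary using (¬_)

record Graph (n : ℕ) : Set₁ where
  field
    Adj     : Fin n → Fin n → Set
    symm    : ∀ {u v} → Adj u v → Adj v u
    irrefl  : ∀ {u} → ¬ Adj u u
open Graph public

record QueueAssignment {n : ℕ} (k : ℕ) (G : Graph n) : Set where
  field
    queue    : ∀ u v → Adj G u v → Fin k
    queue-sym : ∀ u v (e : Adj G u v) → queue u v e ≡ queue v u (symm G e)
open QueueAssignment public

-- A k-queue layout: a linear ordering of the vertices (vertex v is at position
-- pos ⟨$⟩ʳ v) and a partition of the edges into k queues such that no queue contains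
-- two edges {a,d}, {b,c} with a < b < c < d in the ordering.
record QueueLayout {n : ℕ} (k : ℕ) (G : Graph n) : Set₁ where
  field
    pos    : Permutation′ n
    assign : QueueAssignment k G
    no-nest : ∀ a b c d
      → (pos ⟨$⟩ʳ a) < (pos ⟨$⟩ʳ b)
      → (pos ⟨$⟩ʳ b) < (pos ⟨$⟩ʳ c)
      → (pos ⟨$⟩ʳ c) < (pos ⟨$⟩ʳ d)
      → (ead : Adj G a d) → (ebc : Adj G b c)
      → queue assign a d ead ≢ queue assign b c ebc

IsQueueGraph : ∀ {n} → ℕ → Graph n → Set₁
IsQueueGraph k G = QueueLayout k G

record ProperColouring {n : ℕ} (m : ℕ) (G : Graph n) : Set where
  field
    colour : Fin n → Fin m
    proper : ∀ {u v} → Adj G u v → colour u ≢ colour v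

ChromaticAtLeast : ∀ {n} → ℕ → Graph n → Set
ChromaticAtLeast {n} m G = ∀ (j : ℕ) → Data.Nat._<_ j m → ¬ ProperColouring j G
  where import Data.Nat

-- Two universal vertices placed first and last in the vertex order raise the chromatic
-- number by two and cost only one new queue: an edge nested inside another edge has
-- neither end of the order as an endpoint, so the edges at the two new vertices never
-- nest with each other or with the old edges. The induction starts from an 11-vertex
-- 3-queue graph of chromatic number 8: four universal vertices joined to a 5-cycle in
-- which two non-adjacent vertices are doubled, a graph with no proper 3-colouring.
module Submission where

open import Defs
open import Data.Bool using (Bool; true; false; T; _∨_)
open import Data.Bool.Properties using (∨-comm; T?)
open import Data.Empty using (⊥; ⊥-elim)
open import Data.Fin
  using (Fin; zero; suc; toℕ; fromℕ; inject₁; inject≤; punchIn; punchOut; #_; _<_)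
open import Data.Fin.Properties
  using (_≟_; all?; punchOut-injective; inject≤-injective; inject₁-injective; fromℕ≢inject₁; ≤fromℕ)
open import Data.Fin.Permutation using (Permutation′; permutation; _⟨$⟩ʳ_; insert; lift₀)
open import Data.Nat as ℕ using (ℕ; zero; suc; _≤_; _+_; _*_; _∸_; _⊓_; _⊔_; z≤n; s≤s)
open import Data.Nat.Properties using (<⇒≱; ⊓-comm; ⊔-comm; +-comm)
open import Data.Nat.Tactic.RingSolver using (solve-∀)
open import Data.Product using (Σ; _×_; _,_)
open import Data.Unit using (⊤; tt)
open import Data.Vec using (Vec; []; _∷_; lookup)
open import Function using (_∘_)
open import Relation.Binary.Definitions using (Decidable)
open import Relation.Binary.PropositionalEquality
open import Relation.Nullary using (¬_; yes; no; ¬?)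
open import Relation.Nullary.Decidable using (toWitness; _→-dec_)

open ProperColouring

cone : ∀ {n} → Graph n → Graph (suc n)
cone {n} G = record { Adj = Adj⁺ ; symm = λ {u} {v} → symm⁺ u v ; irrefl = λ {u} → irrefl⁺ u }
  where
  Adj⁺ : Fin (suc n) → Fin (suc n) → Set
  Adj⁺ zero    zero    = ⊥
  Adj⁺ zero    (suc _) = ⊤
  Adj⁺ (suc _) zero    = ⊤
  Adj⁺ (suc u) (suc v) = Adj G u v

  symm⁺ : ∀ u v → Adj⁺ u v → Adj⁺ v u
  symm⁺ zero    (suc _) _ = tt
  symm⁺ (suc _) zero    _ = tt
  symm⁺ (suc u) (suc v) e = symm G e

  irrefl⁺ : ∀ u → ¬ Adj⁺ u u
  irrefl⁺ (suc u) = irrefl G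

cone-adj? : ∀ {n} {G : Graph n} → Decidable (Adj G) → Decidable (Adj (cone G))
cone-adj? _    zero    zero    = no λ ()
cone-adj? _    zero    (suc _) = yes tt
cone-adj? _    (suc _) zero    = yes tt
cone-adj? adj? (suc u) (suc v) = adj? u v

¬colourable-cone : ∀ {n c} {G : Graph n} → ¬ ProperColouring c G → ¬ ProperColouring (suc c) (cone G)
¬colourable-cone ¬col χ = ¬col record
  { colour = λ v → punchOut (apex≢ v)
  ; proper = λ e → proper χ e ∘ punchOut-injective (apex≢ _) (apex≢ _)
  }
  where
  apex≢ : ∀ v → colour χ zero ≢ colour χ (suc v)
  apex≢ v = proper χ tt

¬colourable⇒chromaticAtLeast : ∀ {n c} {G : Graph n} → ¬ ProperColouring c G → ChromaticAtLeast (suc c) G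
¬colourable⇒chromaticAtLeast ¬col j j<1+c χ = ¬col record
  { colour = λ v → inject≤ (colour χ v) (ℕ.s≤s⁻¹ j<1+c)
  ; proper = λ e → proper χ e ∘ inject≤-injective _ _ _ _
  }

toℕ-punchIn-fromℕ : ∀ {n} (i : Fin n) → toℕ (punchIn (fromℕ n) i) ≡ toℕ i
toℕ-punchIn-fromℕ zero    = refl
toℕ-punchIn-fromℕ (suc i) = cong suc (toℕ-punchIn-fromℕ i)

-- The apex of the outer cone goes first, that of the inner cone last.
cone²-queueLayout : ∀ {n k} {G : Graph n} → QueueLayout k G → QueueLayout (suc k) (cone (cone G))
cone²-queueLayout {n} {k} {G} L = record
  { pos = pos²
  ; assign = record { queue = queue² ; queue-sym = queue²-sym }
  ; no-nest = no-nest²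
  }
  where
  open QueueLayout L

  pos² : Permutation′ (suc (suc n))
  pos² = insert (suc zero) (fromℕ (suc n)) (lift₀ pos)

  queue² : ∀ u v → Adj (cone (cone G)) u v → Fin (suc k)
  queue² (suc (suc u)) (suc (suc v)) e = inject₁ (queue assign u v e)
  queue² _             _             _ = fromℕ k

  queue²-sym : ∀ u v (e : Adj (cone (cone G)) u v) →
               queue² u v e ≡ queue² v u (symm (cone (cone G)) {u} {v} e)
  queue²-sym zero          (suc zero)    _ = refl
  queue²-sym zero          (suc (suc _)) _ = refl
  queue²-sym (suc zero)    zero          _ = refl
  queue²-sym (suc zero)    (suc (suc _)) _ = refl
  queue²-sym (suc (suc _)) zero          _ = refl
  queue²-sym (suc (suc _)) (suc zero)    _ = refl
  queue²-sym (suc (suc u)) (suc (suc v)) e = cong inject₁ (queue-sym assign u v e)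

  toℕ-pos²-inner : ∀ v → toℕ (pos² ⟨$⟩ʳ suc (suc v)) ≡ suc (toℕ (pos ⟨$⟩ʳ v))
  toℕ-pos²-inner v = cong suc (toℕ-punchIn-fromℕ (pos ⟨$⟩ʳ v))

  pos²-inner-< : ∀ u v → pos² ⟨$⟩ʳ suc (suc u) < pos² ⟨$⟩ʳ suc (suc v) → pos ⟨$⟩ʳ u < pos ⟨$⟩ʳ v
  pos²-inner-< u v = ℕ.s≤s⁻¹ ∘ subst₂ ℕ._<_ (toℕ-pos²-inner u) (toℕ-pos²-inner v)

  pos²-last-maximal : ∀ u → ¬ (pos² ⟨$⟩ʳ suc zero < pos² ⟨$⟩ʳ u)
  pos²-last-maximal u lt = <⇒≱ lt (≤fromℕ (pos² ⟨$⟩ʳ u))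

  no-nest² : ∀ a b c d
    → pos² ⟨$⟩ʳ a < pos² ⟨$⟩ʳ b → pos² ⟨$⟩ʳ b < pos² ⟨$⟩ʳ c → pos² ⟨$⟩ʳ c < pos² ⟨$⟩ʳ d
    → (ead : Adj (cone (cone G)) a d) (ebc : Adj (cone (cone G)) b c)
    → queue² a d ead ≢ queue² b c ebc
  no-nest² _ zero _ _ () _ _
  no-nest² _ (suc zero) c _ _ b<c _ = ⊥-elim (pos²-last-maximal c b<c)
  no-nest² _ (suc (suc _)) zero _ _ () _
  no-nest² _ (suc (suc _)) (suc zero) d _ _ c<d = ⊥-elim (pos²-last-maximal d c<d)
  no-nest² zero (suc (suc _)) (suc (suc _)) _ _ _ _ _ _ = fromℕ≢inject₁
  no-nest² (suc zero) b _ _ a<b = ⊥-elim (pos²-last-maximal b a<b)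
  no-nest² (suc (suc _)) (suc (suc _)) (suc (suc _)) zero _ _ ()
  no-nest² (suc (suc _)) (suc (suc _)) (suc (suc _)) (suc zero) _ _ _ _ _ = fromℕ≢inject₁
  no-nest² (suc (suc a)) (suc (suc b)) (suc (suc c)) (suc (suc d)) a<b b<c c<d ead ebc =
    no-nest a b c d (pos²-inner-< a b a<b) (pos²-inner-< b c b<c) (pos²-inner-< c d c<d) ead ebc
    ∘ inject₁-injective

cone²-iterate : ∀ {n} m → Graph n → Graph (m * 2 + n)
cone²-iterate zero    G = G
cone²-iterate (suc m) G = cone (cone (cone²-iterate m G))

cone²-iterate-queueLayout : ∀ {n k} {G : Graph n} m → QueueLayout k G →
                            QueueLayout (m + k) (cone²-iterate m G)
cone²-iterate-queueLayout zero    L = L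
cone²-iterate-queueLayout (suc m) L = cone²-queueLayout (cone²-iterate-queueLayout m L)

¬colourable-cone²-iterate : ∀ {n c} {G : Graph n} m → ¬ ProperColouring c G →
                            ¬ ProperColouring (m * 2 + c) (cone²-iterate m G)
¬colourable-cone²-iterate zero    ¬col = ¬col
¬colourable-cone²-iterate (suc m) ¬col =
  ¬colourable-cone (¬colourable-cone (¬colourable-cone²-iterate m ¬col))

-- The 5-cycle 0 2 3 4 6 with its vertices 0 and 4 doubled into the edges {0,1} and {4,5}.
blowUpEdge : ℕ → ℕ → Bool
blowUpEdge 0 1 = true
blowUpEdge 0 2 = true
blowUpEdge 1 2 = true
blowUpEdge 2 3 = true
blowUpEdge 3 4 = true
blowUpEdge 3 5 = true
blowUpEdge 4 5 = true
blowUpEdge 4 6 = true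
blowUpEdge 5 6 = true
blowUpEdge 0 6 = true
blowUpEdge 1 6 = true
blowUpEdge _ _ = false

BlowUpAdj : Fin 7 → Fin 7 → Set
BlowUpAdj u v = T (blowUpEdge (toℕ u) (toℕ v) ∨ blowUpEdge (toℕ v) (toℕ u))

blowUpAdj? : Decidable BlowUpAdj
blowUpAdj? u v = T? _

blowUp : Graph 7
blowUp = record
  { Adj = BlowUpAdj
  ; symm = λ {u} {v} → subst T (∨-comm (blowUpEdge (toℕ u) (toℕ v)) _)
  ; irrefl = λ {u} → toWitness {a? = all? λ u → ¬? (blowUpAdj? u u)} _ u
  }

third-colour : ∀ (x y z w : Fin 3) → x ≢ y → z ≢ x → z ≢ y → w ≢ x → w ≢ y → z ≡ w
third-colour = toWitness {a? = all? λ x → all? λ y → all? λ z → all? λ w →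
  ¬? (x ≟ y) →-dec ¬? (z ≟ x) →-dec ¬? (z ≟ y) →-dec ¬? (w ≟ x) →-dec ¬? (w ≟ y) →-dec z ≟ w} _

-- With three colours, the common neighbours 2 and 6 of the edge {0,1} must share the one
-- remaining colour, and so must the common neighbours 3 and 6 of {4,5}; but 2 and 3 are adjacent.
¬3-colourable-blowUp : ¬ ProperColouring 3 blowUp
¬3-colourable-blowUp χ = proper χ {# 2} {# 3} tt (trans c₂≡c₆ (sym c₃≡c₆))
  where
  c : Fin 7 → Fin 3
  c = colour χ

  c₂≡c₆ : c (# 2) ≡ c (# 6)
  c₂≡c₆ = third-colour (c (# 0)) (c (# 1)) (c (# 2)) (c (# 6))
    (proper χ tt) (proper χ tt) (proper χ tt) (proper χ tt) (proper χ tt)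

  c₃≡c₆ : c (# 3) ≡ c (# 6)
  c₃≡c₆ = third-colour (c (# 4)) (c (# 5)) (c (# 3)) (c (# 6))
    (proper χ tt) (proper χ tt) (proper χ tt) (proper χ tt) (proper χ tt)

base : Graph 11
base = cone (cone (cone (cone blowUp)))

¬7-colourable-base : ¬ ProperColouring 7 base
¬7-colourable-base =
  ¬colourable-cone (¬colourable-cone (¬colourable-cone (¬colourable-cone ¬3-colourable-blowUp)))

basePosition : Permutation′ 11
basePosition = permutation (lookup to) (lookup from)
  (toWitness {a? = all? λ i → lookup to (lookup from i) ≟ i} _)
  (toWitness {a? = all? λ i → lookup from (lookup to i) ≟ i} _)
  where
  to from : Vec (Fin 11) 11
  to   = # 3 ∷ # 4 ∷ # 6 ∷ # 7 ∷ # 0 ∷ # 1 ∷ # 2 ∷ # 8 ∷ # 9 ∷ # 10 ∷ # 5 ∷ []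
  from = # 4 ∷ # 5 ∷ # 6 ∷ # 0 ∷ # 1 ∷ # 10 ∷ # 2 ∷ # 3 ∷ # 7 ∷ # 8 ∷ # 9 ∷ []

baseRank : Fin 11 → ℕ
baseRank v = toℕ (basePosition ⟨$⟩ʳ v)

spanQueue : ℕ → ℕ → Fin 3
spanQueue 1 6 = # 1
spanQueue 4 9 = # 1
spanQueue lo hi with hi ∸ lo
... | 0 = # 0
... | 1 = # 0
... | 2 = # 0
... | 3 = # 1
... | 4 = # 1
... | _ = # 2

baseQueue : Fin 11 → Fin 11 → Fin 3
baseQueue u v = spanQueue (baseRank u ⊓ baseRank v) (baseRank u ⊔ baseRank v)

base-queueLayout : QueueLayout 3 base
base-queueLayout = record
  { pos = basePosition
  ; assign = record
    { queue = λ u v _ → baseQueue u v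
    ; queue-sym = λ u v _ →
        cong₂ spanQueue (⊓-comm (baseRank u) _) (⊔-comm (baseRank u) _)
    }
  ; no-nest = toWitness {a? = all? λ a → all? λ b → all? λ c → all? λ d →
      baseRank a ℕ.<? baseRank b →-dec baseRank b ℕ.<? baseRank c →-dec
      baseRank c ℕ.<? baseRank d →-dec
      base-adj? a d →-dec base-adj? b c →-dec ¬? (baseQueue a d ≟ baseQueue b c)} _
  }
  where
  base-adj? : Decidable (Adj base)
  base-adj? = cone-adj? (cone-adj? (cone-adj? (cone-adj? blowUpAdj?)))

corollary8 : ∀ (k : ℕ) → 3 ≤ k →
    Σ ℕ (λ n → Σ (Graph n) (λ G → IsQueueGraph k G × ChromaticAtLeast (2 * k + 2) G))
corollary8 (suc (suc (suc m))) (s≤s (s≤s (s≤s z≤n))) = m * 2 + 11 , G , layout , chromatic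
  where
  G : Graph (m * 2 + 11)
  G = cone²-iterate m base

  layout : QueueLayout (3 + m) G
  layout = subst (λ q → QueueLayout q G) (+-comm m 3) (cone²-iterate-queueLayout m base-queueLayout)

  colour-count : ∀ i → suc (i * 2 + 7) ≡ 2 * (3 + i) + 2
  colour-count = solve-∀

  chromatic : ChromaticAtLeast (2 * (3 + m) + 2) G
  chromatic = subst (λ c → ChromaticAtLeast c G) (colour-count m)
    (¬colourable⇒chromaticAtLeast (¬colourable-cone²-iterate m ¬7-colourable-base))
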